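{- Let $\mathcal{H}$ be a hypergraph, $k$ a positive integer, and $B=B(X,Y)$ the incidence graph of $\mathcal{H}$ with $X=V(\mathcal{H})$, $Y=E(\mathcal{H})$. Define $g,f:V(B)\to\mathbb{Z}$ by $g(v)=f(v)=k$ for $v\in X$, and $g(v)=-2N$, $f(v)=2$ for $v\in Y$, where $N$ is a sufficiently large positive integer. Then $\mathcal{H}$ has a Berge $k$-factor if and only if $B$ has a parity $(g,f)$-factor.
   Context: A hypergraph has a finite vertex set and a finite multiset of edges, each a vertex subset of size at least two. The incidence graph is the simple bipartite graph with parts $X=V(\mathcal{H})$ and $Y=E(\mathcal{H})$ (each edge a separate vertex), $v\in X$ adjacent to $e\in Y$ iff $v\in e$. For a graph $G$ (multiple edges allowed) with $V(G)=V(\mathcal{H})$, a subhypergraph $\mathcal{H}'$ is Berge-$G$ if there is a bijection $\phi:E(G)\to E(\mathcal{H}')$ with $e\subseteq\phi(e)$. A Berge $k$-factor is a spanning subhypergraph that is Berge-$G$ for some $k$-regular graph $G$. For integer functions $g\le f$ on $V(G)$ with $g(v)\equiv f(v)\pmod 2$, a parity $(g,f)$-factor of $G$ is a spanning subgraph $F$ with $g(v)\le\deg_F(v)\le f(v)$ and $\deg_F(v)\equiv f(v)\pmod 2$ for all $v$. -}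

module Defs where

open import Data.Nat as ℕ using (ℕ; zero; suc; _≥_)
open import Data.Integer as ℤ using (ℤ; +_; -_; _-_)
open import Data.Integer.Divisibility using () renaming (_∣_ to _∣ℤ_)
open import Data.Bool using (Bool; true; false; if_then_else_; _∨_)
open import Data.Fin using (Fin; zero; suc; splitAt; _≟_)
import Data.Empty
open import Data.Fin.Subset using (Subset; _∈_; ∣_∣)
open import Data.Fin.Subset.Properties using (_∈?_)
open import Data.Sum using (_⊎_; inj₁; inj₂)
open import Data.Product using (Σ; ∃; _×_; _,_; proj₁; proj₂)
open import Relation.Nullary.Decidable using (⌊_⌋)
open import Relation.Binary.PropositionalEquality using (_≡_)
open import Function.Definitions using (Injective)

count : ∀ {N} → (Fin N → Bool) → ℕ
count {zero} p = 0
count {suc N} p = (if p zero then 1 else 0) ℕ.+ count (λ i → p (suc i))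

-- Hypergraphs: vertex set Fin n, edge multiset indexed by Fin m
-- (two indices may carry the same vertex subset), each edge of size ≥ 2.

record Hypergraph : Set where
  field
    n : ℕ
    m : ℕ
    edge : Fin m → Subset n
    edge-size : ∀ j → ∣ edge j ∣ ≥ 2
open Hypergraph public

record Multigraph (n : ℕ) : Set where
  field
    p : ℕ
    ends : Fin p → Fin n × Fin n
    loopless : ∀ i → proj₁ (ends i) ≡ proj₂ (ends i) → Data.Empty.⊥
open Multigraph public



mdeg : ∀ {n} → Multigraph n → Fin n → ℕ
mdeg G v = count (λ i → ⌊ proj₁ (ends G i) ≟ v ⌋ ∨ ⌊ proj₂ (ends G i) ≟ v ⌋)

Regular : ∀ {n} → ℕ → Multigraph n → Set
Regular k G = ∀ v → mdeg G v ≡ k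

-- A spanning subhypergraph H' of H is given by the sub-multiset S of edge
-- indices.  H' is Berge-G iff there is a bijection φ : E(G) → E(H')
-- with e ⊆ φ(e).
BergeG : (H : Hypergraph) → Subset (m H) → Multigraph (n H) → Set
BergeG H S G =
  Σ (Fin (p G) → Fin (m H)) λ φ →
      Injective _≡_ _≡_ φ
    × (∀ i → φ i ∈ S)
    × (∀ j → j ∈ S → ∃ λ i → φ i ≡ j)
    × (∀ i → proj₁ (ends G i) ∈ edge H (φ i) × proj₂ (ends G i) ∈ edge H (φ i))

HasBergeFactor : ℕ → Hypergraph → Set
HasBergeFactor k H =
  Σ (Subset (m H)) λ S → Σ (Multigraph (n H)) λ G → Regular k G × BergeG H S G

record Graph : Set where
  field
    N : ℕ
    adj : Fin N → Fin N → Bool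
    adj-sym : ∀ u v → adj u v ≡ adj v u
    adj-irrefl : ∀ v → adj v v ≡ false
open Graph public

record SpanningSubgraph (G : Graph) : Set where
  field
    sel : Fin (N G) → Fin (N G) → Bool
    sel-sym : ∀ u v → sel u v ≡ sel v u
    sel-⊆ : ∀ u v → sel u v ≡ true → adj G u v ≡ true
open SpanningSubgraph public

deg : ∀ {G} → SpanningSubgraph G → Fin (N G) → ℕ
deg F v = count (sel F v)

IsParityFactor : (G : Graph) → (g f : Fin (N G) → ℤ) → SpanningSubgraph G → Set
IsParityFactor G g f F =
  ∀ v → (g v ℤ.≤ + deg F v) × (+ deg F v ℤ.≤ f v) × (+ 2 ∣ℤ (f v - + deg F v))

HasParityFactor : (G : Graph) → (g f : Fin (N G) → ℤ) → Set
HasParityFactor G g f = Σ (SpanningSubgraph G) (IsParityFactor G g f)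

-- Incidence graph B(X,Y): vertex set Fin (n + m); the first n are X = V(H),
-- the last m are Y = E(H) (via splitAt).

incAdj : (H : Hypergraph) → Fin (n H ℕ.+ m H) → Fin (n H ℕ.+ m H) → Bool
incAdj H u w with splitAt (n H) u | splitAt (n H) w
... | inj₁ v | inj₂ e = ⌊ v ∈? edge H e ⌋
... | inj₂ e | inj₁ v = ⌊ v ∈? edge H e ⌋
... | inj₁ _ | inj₁ _ = false
... | inj₂ _ | inj₂ _ = false

incAdj-sym : ∀ H u w → incAdj H u w ≡ incAdj H w u
incAdj-sym H u w with splitAt (n H) u | splitAt (n H) w
... | inj₁ v | inj₂ e = Relation.Binary.PropositionalEquality.refl
... | inj₂ e | inj₁ v = Relation.Binary.PropositionalEquality.refl
... | inj₁ _ | inj₁ _ = Relation.Binary.PropositionalEquality.refl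
... | inj₂ _ | inj₂ _ = Relation.Binary.PropositionalEquality.refl

incAdj-irrefl : ∀ H v → incAdj H v v ≡ false
incAdj-irrefl H v with splitAt (n H) v
... | inj₁ _ = Relation.Binary.PropositionalEquality.refl
... | inj₂ _ = Relation.Binary.PropositionalEquality.refl

Incidence : Hypergraph → Graph
Incidence H = record
  { N = n H ℕ.+ m H ; adj = incAdj H
  ; adj-sym = incAdj-sym H ; adj-irrefl = incAdj-irrefl H }

gFun : (H : Hypergraph) → ℕ → ℕ → Fin (n H ℕ.+ m H) → ℤ
gFun H k bigN u with splitAt (n H) u
... | inj₁ _ = + k
... | inj₂ _ = - (+ (2 ℕ.* bigN))

fFun : (H : Hypergraph) → ℕ → Fin (n H ℕ.+ m H) → ℤ
fFun H k u with splitAt (n H) u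
... | inj₁ _ = + k
... | inj₂ _ = + 2

-- A parity (g,f)-factor F of the incidence graph B gives every vertex of H
-- degree exactly k and every hyperedge degree 0 or 2: the upper bound f = 2 and
-- the parity condition force this, while the lower bound g = -2N < 0 is void.
-- So a parity factor is the same thing as a set of flags (v , e) with v ∈ e,
-- k of them at each vertex and 0 or 2 at each hyperedge.  A Berge k-factor,
-- Berge-G via φ, gives such flags by flagging φ(xy) at x and at y; conversely
-- the hyperedges carrying two flags form a Berge k-factor, each of them standing
-- for the graph edge between its two flagged vertices.

module Submission where

open import Defs
open import Data.Nat as ℕ using (ℕ; zero; suc; _+_; _≥_; _≤_; z≤n; s≤s)
open import Data.Nat.Properties using (+-suc; +-identityʳ; ≤-antisym)
open import Data.Nat.Divisibility using (divides; _∣0)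
open import Data.Integer as ℤ using (ℤ; +_; -_; _-_; +≤+)
open import Data.Integer.Properties using (drop‿+≤+; neg-≤-pos; +-inverseʳ)
  renaming (≤-refl to ℤ-≤-refl)
open import Data.Integer.Divisibility using () renaming (_∣_ to _∣ℤ_)
open import Data.Bool using (Bool; true; false; if_then_else_; _∧_; _∨_)
open import Data.Bool.Properties
  using (T-≡; ⇔→≡; ∧-identityʳ; ∧-zeroʳ; ∨-identityʳ; ∨-zeroʳ)
open import Data.Fin using (Fin; zero; suc; _↑ˡ_; _↑ʳ_; splitAt; join)
open import Data.Fin.Properties
  using (_≟_; suc-injective; splitAt-↑ˡ; splitAt-↑ʳ; join-splitAt)
open import Data.Fin.Subset using (Subset; _∈_)
open import Data.Fin.Subset.Properties using (_∈?_)
open import Data.Vec using (tabulate)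
open import Data.Vec.Properties using (lookup∘tabulate; []=⇒lookup; lookup⇒[]=)
open import Data.Product using (∃; _×_; _,_; proj₁; proj₂)
import Data.Product as Product
open import Data.Sum using (_⊎_; inj₁; inj₂; [_,_])
open import Function using (_∘_; id)
open import Function.Bundles using (_⇔_; mk⇔; Equivalence)
open import Function.Definitions using (Injective)
open import Relation.Nullary using (Dec; yes; no; contradiction)
open import Relation.Nullary.Decidable
  using (⌊_⌋; toWitness; fromWitness; ⌊⌋-map′)
open import Relation.Binary.PropositionalEquality

toWitness-≡ : ∀ {a} {A : Set a} (a? : Dec A) → ⌊ a? ⌋ ≡ true → A
toWitness-≡ a? = toWitness {a? = a?} ∘ Equivalence.from T-≡

fromWitness-≡ : ∀ {a} {A : Set a} (a? : Dec A) → A → ⌊ a? ⌋ ≡ true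
fromWitness-≡ a? = Equivalence.to T-≡ ∘ fromWitness {a? = a?}

∈-tabulate⁺ : ∀ {N} (s : Fin N → Bool) {e} → s e ≡ true → e ∈ tabulate s
∈-tabulate⁺ s {e} se = lookup⇒[]= e (tabulate s) (trans (lookup∘tabulate s e) se)

∈-tabulate⁻ : ∀ {N} (s : Fin N → Bool) {e} → e ∈ tabulate s → s e ≡ true
∈-tabulate⁻ s {e} e∈ = trans (sym (lookup∘tabulate s e)) ([]=⇒lookup e∈)

count-cong : ∀ {N} {p q : Fin N → Bool} → (∀ i → p i ≡ q i) → count p ≡ count q
count-cong {zero}  p≗q = refl
count-cong {suc N} p≗q rewrite p≗q zero = cong₂ _+_ refl (count-cong (p≗q ∘ suc))

count-false : ∀ {N} {p : Fin N → Bool} → (∀ i → p i ≡ false) → count p ≡ 0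
count-false {zero}  p≗false = refl
count-false {suc N} p≗false rewrite p≗false zero = count-false (p≗false ∘ suc)

count≡0⇒false : ∀ {N} (p : Fin N → Bool) → count p ≡ 0 → ∀ i → p i ≡ false
count≡0⇒false {suc N} p c≡0 i with p zero in p₀
count≡0⇒false {suc N} p () i       | true
count≡0⇒false {suc N} p c≡0 zero    | false = p₀
count≡0⇒false {suc N} p c≡0 (suc i) | false = count≡0⇒false (p ∘ suc) c≡0 i

count-↑ : ∀ n {m} (p : Fin (n + m) → Bool) →
          count p ≡ count (λ v → p (v ↑ˡ m)) + count (λ e → p (n ↑ʳ e))
count-↑ zero    p = refl
count-↑ (suc n) p with p zero
... | true  = cong suc (count-↑ n (p ∘ suc))
... | false = count-↑ n (p ∘ suc)

count-∨ : ∀ {N} (p q : Fin N → Bool) → (∀ i → p i ∧ q i ≡ false) →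
          count (λ i → p i ∨ q i) ≡ count p + count q
count-∨ {zero}  p q disjoint = refl
count-∨ {suc N} p q disjoint with p zero | q zero | disjoint zero
... | true  | true  | ()
... | true  | false | _ = cong suc (count-∨ (p ∘ suc) (q ∘ suc) (disjoint ∘ suc))
... | false | true  | _ = trans (cong suc (count-∨ (p ∘ suc) (q ∘ suc) (disjoint ∘ suc)))
                                (sym (+-suc (count (p ∘ suc)) _))
... | false | false | _ = count-∨ (p ∘ suc) (q ∘ suc) (disjoint ∘ suc)

count-≟ : ∀ {N} (a : Fin N) → count (λ v → ⌊ a ≟ v ⌋) ≡ 1
count-≟ {suc N} zero = cong suc (count-false {N} (λ _ → refl))
count-≟ (suc a)      = trans (count-cong (λ v → ⌊⌋-map′ _ _ (a ≟ v))) (count-≟ a)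

count-pair : ∀ {N} {a b : Fin N} → a ≢ b → count (λ v → ⌊ a ≟ v ⌋ ∨ ⌊ b ≟ v ⌋) ≡ 2
count-pair {a = a} {b} a≢b =
  trans (count-∨ _ _ disjoint) (cong₂ _+_ (count-≟ a) (count-≟ b))
  where
  disjoint : ∀ v → ⌊ a ≟ v ⌋ ∧ ⌊ b ≟ v ⌋ ≡ false
  disjoint v with a ≟ v | b ≟ v
  ... | yes a≡v | yes b≡v = contradiction (trans a≡v (sym b≡v)) a≢b
  ... | yes _   | no _    = refl
  ... | no _    | _       = refl

image : ∀ {p m} → (Fin p → Fin m) → (Fin p → Bool) → Fin m → Bool
image {zero}  φ r e = false
image {suc p} φ r e = (⌊ φ zero ≟ e ⌋ ∧ r zero) ∨ image (φ ∘ suc) (r ∘ suc) e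

image⇒ : ∀ {p m} (φ : Fin p → Fin m) r {e} → image φ r e ≡ true →
         ∃ λ i → φ i ≡ e × r i ≡ true
image⇒ {suc p} φ r {e} h with φ zero ≟ e | r zero in r₀
... | yes φ₀≡e | true  = zero , φ₀≡e , r₀
... | yes _    | false = Product.map suc id (image⇒ (φ ∘ suc) (r ∘ suc) h)
... | no _     | _     = Product.map suc id (image⇒ (φ ∘ suc) (r ∘ suc) h)

image-outside : ∀ {p m} (φ : Fin p → Fin m) r {e} → (∀ i → φ i ≢ e) → image φ r e ≡ false
image-outside {zero}  φ r     φ≢e = refl
image-outside {suc p} φ r {e} φ≢e with φ zero ≟ e
... | yes φ₀≡e = contradiction φ₀≡e (φ≢e zero)
... | no _     = image-outside (φ ∘ suc) (r ∘ suc) (φ≢e ∘ suc)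

∘suc-injective : ∀ {p m} {φ : Fin (suc p) → Fin m} →
                 Injective _≡_ _≡_ φ → Injective _≡_ _≡_ (φ ∘ suc)
∘suc-injective φ-injective eq = suc-injective (φ-injective eq)

image-suc-at-zero : ∀ {p m} {φ : Fin (suc p) → Fin m} → Injective _≡_ _≡_ φ →
                    (r : Fin (suc p) → Bool) → image (φ ∘ suc) (r ∘ suc) (φ zero) ≡ false
image-suc-at-zero {φ = φ} φ-injective r = image-outside (φ ∘ suc) (r ∘ suc) φ∘suc≢φ₀
  where
  φ∘suc≢φ₀ : ∀ i → φ (suc i) ≢ φ zero
  φ∘suc≢φ₀ i eq with φ-injective eq
  ... | ()

image-at : ∀ {p m} {φ : Fin p → Fin m} → Injective _≡_ _≡_ φ →
           ∀ r i → image φ r (φ i) ≡ r i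
image-at {φ = φ} φ-injective r zero with φ zero ≟ φ zero
... | yes _    = trans (cong (r zero ∨_) (image-suc-at-zero φ-injective r)) (∨-identityʳ (r zero))
... | no φ₀≢φ₀ = contradiction refl φ₀≢φ₀
image-at {φ = φ} φ-injective r (suc i) with φ zero ≟ φ (suc i)
... | yes eq = contradiction (φ-injective eq) λ ()
... | no _   = image-at (∘suc-injective φ-injective) (r ∘ suc) i

count-image : ∀ {p m} {φ : Fin p → Fin m} → Injective _≡_ _≡_ φ →
              ∀ r → count (image φ r) ≡ count r
count-image {zero}  {m}         φ-injective r = count-false {m} (λ _ → refl)
count-image {suc p} {m} {φ = φ} φ-injective r =
  trans (count-∨ head (image (φ ∘ suc) (r ∘ suc)) disjoint)
        (cong₂ _+_ count-head (count-image (∘suc-injective φ-injective) (r ∘ suc)))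
  where
  head : Fin m → Bool
  head e = ⌊ φ zero ≟ e ⌋ ∧ r zero

  disjoint : ∀ e → head e ∧ image (φ ∘ suc) (r ∘ suc) e ≡ false
  disjoint e with φ zero ≟ e
  ... | no _ = refl
  ... | yes refl = trans (cong (r zero ∧_) (image-suc-at-zero φ-injective r)) (∧-zeroʳ (r zero))

  count-head : count head ≡ (if r zero then 1 else 0)
  count-head with r zero
  ... | true  = trans (count-cong {m} (λ e → ∧-identityʳ _)) (count-≟ (φ zero))
  ... | false = count-false {m} (λ e → ∧-zeroʳ _)

record Enumeration {N} (q : Fin N → Bool) (c : ℕ) : Set where
  field
    at         : Fin c → Fin N
    injective  : Injective _≡_ _≡_ at
    sound      : ∀ i → q (at i) ≡ true
    complete   : ∀ v → q v ≡ true → ∃ λ i → at i ≡ v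

module _ {N} {q : Fin (suc N) → Bool} {c} (E : Enumeration (q ∘ suc) c) where
  open Enumeration E

  enumeration-cons : q zero ≡ true → Enumeration q (suc c)
  enumeration-cons q₀ = record
    { at        = λ { zero → zero ; (suc i) → suc (at i) }
    ; injective = λ { {zero} {zero} _ → refl
                    ; {suc i} {suc j} eq → cong suc (injective (suc-injective eq)) }
    ; sound     = λ { zero → q₀ ; (suc i) → sound i }
    ; complete  = λ { zero _ → zero , refl
                    ; (suc v) h → Product.map suc (cong suc) (complete v h) } }

  enumeration-skip : q zero ≡ false → Enumeration q c
  enumeration-skip q₀ = record
    { at        = suc ∘ at
    ; injective = injective ∘ suc-injective
    ; sound     = sound
    ; complete  = λ { zero h → contradiction (trans (sym q₀) h) λ ()
                    ; (suc v) h → Product.map id (cong suc) (complete v h) } }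

enumerate : ∀ {N} (q : Fin N → Bool) → Enumeration q (count q)
enumerate {zero}  q = record
  { at = λ () ; injective = λ {} ; sound = λ () ; complete = λ () }
enumerate {suc N} q with q zero in q₀
... | true  = enumeration-cons (enumerate (q ∘ suc)) q₀
... | false = enumeration-skip (enumerate (q ∘ suc)) q₀

module _ {N} {q : Fin N → Bool} (E : Enumeration q 2) where
  open Enumeration E

  enumeration₂-distinct : at zero ≢ at (suc zero)
  enumeration₂-distinct eq with injective eq
  ... | ()

  enumeration₂-indicator : ∀ v → (⌊ at zero ≟ v ⌋ ∨ ⌊ at (suc zero) ≟ v ⌋) ≡ q v
  enumeration₂-indicator v = ⇔→≡ (mk⇔ to from)
    where
    to : ⌊ at zero ≟ v ⌋ ∨ ⌊ at (suc zero) ≟ v ⌋ ≡ true → q v ≡ true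
    to h with at zero ≟ v | at (suc zero) ≟ v
    ... | yes refl | _        = sound zero
    ... | no _     | yes refl = sound (suc zero)
    ... | no _     | no _     = contradiction h λ ()

    from : q v ≡ true → ⌊ at zero ≟ v ⌋ ∨ ⌊ at (suc zero) ≟ v ⌋ ≡ true
    from h with complete v h
    ... | zero , refl rewrite fromWitness-≡ (at zero ≟ at zero) refl = refl
    ... | suc zero , refl rewrite fromWitness-≡ (at (suc zero) ≟ at (suc zero)) refl =
      ∨-zeroʳ _

-- IsParityFactor G g f F is definitionally ∀ v → ParityBounds (g v) (f v) (deg F v).
ParityBounds : ℤ → ℤ → ℕ → Set
ParityBounds g f d = (g ℤ.≤ + d) × (+ d ℤ.≤ f) × (+ 2 ∣ℤ (f - + d))

parityBounds-exact : ∀ {k d} → ParityBounds (+ k) (+ k) d ⇔ d ≡ k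
parityBounds-exact {k} = mk⇔
  (λ (k≤d , d≤k , _) → ≤-antisym (drop‿+≤+ d≤k) (drop‿+≤+ k≤d))
  (λ { refl → ℤ-≤-refl , ℤ-≤-refl , subst (+ 2 ∣ℤ_) (sym (+-inverseʳ (+ k))) (2 ∣0) })

parityBounds-even≤2 : ∀ {x d} → ParityBounds (- (+ x)) (+ 2) d ⇔ (d ≡ 0 ⊎ d ≡ 2)
parityBounds-even≤2 = mk⇔ (λ (_ , d≤2 , 2∣2-d) → even≤2 _ (drop‿+≤+ d≤2) 2∣2-d) from
  where
  even≤2 : ∀ d → d ≤ 2 → + 2 ∣ℤ (+ 2 - + d) → d ≡ 0 ⊎ d ≡ 2
  even≤2 0 _ _ = inj₁ refl
  even≤2 1 _ (divides (suc _) ())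
  even≤2 2 _ _ = inj₂ refl
  even≤2 (suc (suc (suc _))) (s≤s (s≤s ())) _

  from : ∀ {x d} → d ≡ 0 ⊎ d ≡ 2 → ParityBounds (- (+ x)) (+ 2) d
  from (inj₁ refl) = neg-≤-pos , +≤+ z≤n , divides 1 refl
  from (inj₂ refl) = neg-≤-pos , ℤ-≤-refl , divides 0 refl

record FlagFactor (k : ℕ) (H : Hypergraph) : Set where
  field
    flag            : Fin (n H) → Fin (m H) → Bool
    flag⇒∈          : ∀ v e → flag v e ≡ true → v ∈ edge H e
    count-at-vertex : ∀ v → count (flag v) ≡ k
    count-at-edge   : ∀ e → count (λ v → flag v e) ≡ 0 ⊎ count (λ v → flag v e) ≡ 2

sel-nonadjacent : ∀ {G} (F : SpanningSubgraph G) {u w} → adj G u w ≡ false → sel F u w ≡ false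
sel-nonadjacent F {u} {w} ¬adj with sel F u w in sel≡
... | false = refl
... | true  = contradiction (trans (sym (sel-⊆ F u w sel≡)) ¬adj) λ ()

module IncidenceGraph (H : Hypergraph) where

  B : Graph
  B = Incidence H

  vertex : Fin (n H) → Fin (N B)
  vertex v = v ↑ˡ m H

  hyperedge : Fin (m H) → Fin (N B)
  hyperedge e = n H ↑ʳ e

  vertex-or-hyperedge : (P : Fin (N B) → Set) →
                        (∀ v → P (vertex v)) → (∀ e → P (hyperedge e)) → ∀ u → P u
  vertex-or-hyperedge P P-vertex P-hyperedge u =
    subst P (join-splitAt (n H) (m H) u)
          ([_,_] {C = P ∘ join (n H) (m H)} P-vertex P-hyperedge (splitAt (n H) u))

  adj-vertex-vertex : ∀ v w → adj B (vertex v) (vertex w) ≡ false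
  adj-vertex-vertex v w rewrite splitAt-↑ˡ (n H) v (m H) | splitAt-↑ˡ (n H) w (m H) = refl

  adj-hyperedge-hyperedge : ∀ e f → adj B (hyperedge e) (hyperedge f) ≡ false
  adj-hyperedge-hyperedge e f
    rewrite splitAt-↑ʳ (n H) (m H) e | splitAt-↑ʳ (n H) (m H) f = refl

  adj-vertex-hyperedge : ∀ v e → adj B (vertex v) (hyperedge e) ≡ ⌊ v ∈? edge H e ⌋
  adj-vertex-hyperedge v e
    rewrite splitAt-↑ˡ (n H) v (m H) | splitAt-↑ʳ (n H) (m H) e = refl

  module _ (F : SpanningSubgraph B) where

    flagsOf : Fin (n H) → Fin (m H) → Bool
    flagsOf v e = sel F (vertex v) (hyperedge e)

    flagsOf⇒∈ : ∀ v e → flagsOf v e ≡ true → v ∈ edge H e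
    flagsOf⇒∈ v e h =
      toWitness-≡ (v ∈? edge H e) (trans (sym (adj-vertex-hyperedge v e)) (sel-⊆ F _ _ h))

    deg-vertex : ∀ v → deg F (vertex v) ≡ count (flagsOf v)
    deg-vertex v =
      trans (count-↑ (n H) (sel F (vertex v)))
            (cong (_+ count (flagsOf v))
                  (count-false {n H} (λ w → sel-nonadjacent F (adj-vertex-vertex v w))))

    deg-hyperedge : ∀ e → deg F (hyperedge e) ≡ count (λ v → flagsOf v e)
    deg-hyperedge e = begin
      deg F (hyperedge e)
        ≡⟨ count-↑ (n H) (sel F (hyperedge e)) ⟩
      count (λ v → sel F (hyperedge e) (vertex v)) + count (sel F (hyperedge e) ∘ hyperedge)
        ≡⟨ cong₂ _+_ (count-cong {n H} (λ v → sel-sym F (hyperedge e) (vertex v)))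
                     (count-false {m H} (λ f →
                        sel-nonadjacent F (adj-hyperedge-hyperedge e f))) ⟩
      count (λ v → flagsOf v e) + 0
        ≡⟨ +-identityʳ _ ⟩
      count (λ v → flagsOf v e) ∎
      where open ≡-Reasoning

  module _ (flag : Fin (n H) → Fin (m H) → Bool)
           (flag⇒∈ : ∀ v e → flag v e ≡ true → v ∈ edge H e) where

    private
      flagSel : Fin (N B) → Fin (N B) → Bool
      flagSel u w with splitAt (n H) u | splitAt (n H) w
      ... | inj₁ v | inj₂ e = flag v e
      ... | inj₂ e | inj₁ v = flag v e
      ... | inj₁ _ | inj₁ _ = false
      ... | inj₂ _ | inj₂ _ = false

      flagSel-sym : ∀ u w → flagSel u w ≡ flagSel w u
      flagSel-sym u w with splitAt (n H) u | splitAt (n H) w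
      ... | inj₁ v | inj₂ e = refl
      ... | inj₂ e | inj₁ v = refl
      ... | inj₁ _ | inj₁ _ = refl
      ... | inj₂ _ | inj₂ _ = refl

      flagSel-⊆ : ∀ u w → flagSel u w ≡ true → adj B u w ≡ true
      flagSel-⊆ u w with splitAt (n H) u | splitAt (n H) w
      ... | inj₁ v | inj₂ e = fromWitness-≡ (v ∈? edge H e) ∘ flag⇒∈ v e
      ... | inj₂ e | inj₁ v = fromWitness-≡ (v ∈? edge H e) ∘ flag⇒∈ v e
      ... | inj₁ _ | inj₁ _ = λ ()
      ... | inj₂ _ | inj₂ _ = λ ()

    subgraphOf : SpanningSubgraph B
    subgraphOf = record { sel = flagSel ; sel-sym = flagSel-sym ; sel-⊆ = flagSel-⊆ }

    flagsOf-subgraphOf : ∀ v e → flagsOf subgraphOf v e ≡ flag v e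
    flagsOf-subgraphOf v e
      rewrite splitAt-↑ˡ (n H) v (m H) | splitAt-↑ʳ (n H) (m H) e = refl

  module _ (k bigN : ℕ) where

    parity-vertex : ∀ v d →
      ParityBounds (gFun H k bigN (vertex v)) (fFun H k (vertex v)) d ⇔ d ≡ k
    parity-vertex v d rewrite splitAt-↑ˡ (n H) v (m H) = parityBounds-exact

    parity-hyperedge : ∀ e d →
      ParityBounds (gFun H k bigN (hyperedge e)) (fFun H k (hyperedge e)) d ⇔ (d ≡ 0 ⊎ d ≡ 2)
    parity-hyperedge e d rewrite splitAt-↑ʳ (n H) (m H) e = parityBounds-even≤2

    parityFactor⇒flagFactor : HasParityFactor B (gFun H k bigN) (fFun H k) → FlagFactor k H
    parityFactor⇒flagFactor (F , parity) = record
      { flag            = flagsOf F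
      ; flag⇒∈          = flagsOf⇒∈ F
      ; count-at-vertex = λ v →
          trans (sym (deg-vertex F v)) (Equivalence.to (parity-vertex v _) (parity (vertex v)))
      ; count-at-edge   = λ e →
          subst (λ d → d ≡ 0 ⊎ d ≡ 2) (deg-hyperedge F e)
                (Equivalence.to (parity-hyperedge e _) (parity (hyperedge e)))
      }

    flagFactor⇒parityFactor : FlagFactor k H → HasParityFactor B (gFun H k bigN) (fFun H k)
    flagFactor⇒parityFactor Φ = F , vertex-or-hyperedge _ at-vertex at-hyperedge
      where
      open FlagFactor Φ
      F : SpanningSubgraph B
      F = subgraphOf flag flag⇒∈

      count-flagsOf : ∀ v → count (flagsOf F v) ≡ count (flag v)
      count-flagsOf v = count-cong {m H} (flagsOf-subgraphOf flag flag⇒∈ v)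

      at-vertex : ∀ v → ParityBounds (gFun H k bigN (vertex v)) (fFun H k (vertex v))
                                     (deg F (vertex v))
      at-vertex v = Equivalence.from (parity-vertex v _)
        (trans (deg-vertex F v) (trans (count-flagsOf v) (count-at-vertex v)))

      at-hyperedge : ∀ e → ParityBounds (gFun H k bigN (hyperedge e)) (fFun H k (hyperedge e))
                                        (deg F (hyperedge e))
      at-hyperedge e = Equivalence.from (parity-hyperedge e _)
        (subst (λ d → d ≡ 0 ⊎ d ≡ 2)
               (sym (trans (deg-hyperedge F e)
                           (count-cong {n H} (λ v → flagsOf-subgraphOf flag flag⇒∈ v e))))
               (count-at-edge e))

isEnd : ∀ {n} (G : Multigraph n) → Fin (p G) → Fin n → Bool
isEnd G i v = ⌊ proj₁ (ends G i) ≟ v ⌋ ∨ ⌊ proj₂ (ends G i) ≟ v ⌋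

isEnd⇒∈ : ∀ {n} (G : Multigraph n) {i v} {S : Subset n} →
          proj₁ (ends G i) ∈ S × proj₂ (ends G i) ∈ S → isEnd G i v ≡ true → v ∈ S
isEnd⇒∈ G {i} {v} (end₁∈S , end₂∈S) h with proj₁ (ends G i) ≟ v | proj₂ (ends G i) ≟ v
... | yes refl | _        = end₁∈S
... | no _     | yes refl = end₂∈S
... | no _     | no _     = contradiction h λ ()

module _ {k : ℕ} {H : Hypergraph} where

  bergeFactor⇒flagFactor : HasBergeFactor k H → FlagFactor k H
  bergeFactor⇒flagFactor (S , G , regular , φ , φ-injective , φ∈S , S⊆φ , ends∈) = record
    { flag            = flag
    ; flag⇒∈          = flag⇒∈
    ; count-at-vertex = λ v → trans (count-image φ-injective (λ i → isEnd G i v)) (regular v)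
    ; count-at-edge   = count-at-edge
    }
    where
    flag : Fin (n H) → Fin (m H) → Bool
    flag v = image φ (λ i → isEnd G i v)

    flag⇒∈ : ∀ v e → flag v e ≡ true → v ∈ edge H e
    flag⇒∈ v e h with image⇒ φ (λ i → isEnd G i v) h
    ... | i , refl , end = isEnd⇒∈ G (ends∈ i) end

    count-at-edge : ∀ e → count (λ v → flag v e) ≡ 0 ⊎ count (λ v → flag v e) ≡ 2
    count-at-edge e with e ∈? S
    ... | no e∉S = inj₁ (count-false {n H} (λ v →
            image-outside φ _ (λ i φi≡e → e∉S (subst (_∈ S) φi≡e (φ∈S i)))))
    ... | yes e∈S with S⊆φ e e∈S
    ...   | i , refl = inj₂ (trans (count-cong {n H} (λ v → image-at φ-injective _ i))
                                   (count-pair (loopless G i)))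

  flagFactor⇒bergeFactor : FlagFactor k H → HasBergeFactor k H
  flagFactor⇒bergeFactor Φ = tabulate chosen , G , regular , berge
    where
    open FlagFactor Φ

    chosen : Fin (m H) → Bool
    chosen e = ⌊ count (λ v → flag v e) ℕ.≟ 2 ⌋

    flag⇒chosen : ∀ {v e} → flag v e ≡ true → chosen e ≡ true
    flag⇒chosen {v} {e} h with count-at-edge e
    ... | inj₂ c≡2 = fromWitness-≡ (_ ℕ.≟ 2) c≡2
    ... | inj₁ c≡0 = contradiction (trans (sym h) (count≡0⇒false _ c≡0 v)) λ ()

    open Enumeration (enumerate chosen)

    endsOf : ∀ i → Enumeration (λ v → flag v (at i)) 2
    endsOf i = subst (Enumeration _) (toWitness-≡ (_ ℕ.≟ 2) (sound i)) (enumerate _)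

    G : Multigraph (n H)
    G = record
      { p        = count chosen
      ; ends     = λ i → Enumeration.at (endsOf i) zero , Enumeration.at (endsOf i) (suc zero)
      ; loopless = enumeration₂-distinct ∘ endsOf
      }

    image-flag : ∀ v e → image at (λ i → flag v (at i)) e ≡ flag v e
    image-flag v e with chosen e in chosen-e
    ... | true with complete e chosen-e
    ...   | i , refl = image-at injective _ i
    image-flag v e | false =
      trans (image-outside at _ (unlisted chosen-e)) (sym (unflagged chosen-e))
      where
      unlisted : chosen e ≡ false → ∀ i → at i ≢ e
      unlisted e-out i refl = contradiction (trans (sym (sound i)) e-out) λ ()

      unflagged : chosen e ≡ false → flag v e ≡ false
      unflagged e-out with flag v e in flag-ve
      ... | false = refl
      ... | true  = contradiction (trans (sym (flag⇒chosen flag-ve)) e-out) λ ()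

    regular : Regular k G
    regular v = begin
      mdeg G v
        ≡⟨ count-cong (λ i → enumeration₂-indicator (endsOf i) v) ⟩
      count (λ i → flag v (at i))
        ≡⟨ count-image injective _ ⟨
      count (image at (λ i → flag v (at i)))
        ≡⟨ count-cong (image-flag v) ⟩
      count (flag v)
        ≡⟨ count-at-vertex v ⟩
      k ∎
      where open ≡-Reasoning

    berge : BergeG H (tabulate chosen) G
    berge = at , injective ,
            (λ i → ∈-tabulate⁺ chosen (sound i)) ,
            (λ e → complete e ∘ ∈-tabulate⁻ chosen) ,
            (λ i → flag⇒∈ _ _ (Enumeration.sound (endsOf i) zero) ,
                   flag⇒∈ _ _ (Enumeration.sound (endsOf i) (suc zero)))

lemma2 : (H : Hypergraph) (k : ℕ) → k ≥ 1 →
    ∃ λ N₀ → ∀ bigN → bigN ≥ N₀ → 1 ≤ bigN →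
      HasBergeFactor k H ⇔ HasParityFactor (Incidence H) (gFun H k bigN) (fFun H k)
lemma2 H k _ = 0 , λ bigN _ _ → mk⇔
  (flagFactor⇒parityFactor k bigN ∘ bergeFactor⇒flagFactor)
  (flagFactor⇒bergeFactor ∘ parityFactor⇒flagFactor k bigN)
  where open IncidenceGraph H
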